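{- Let $(D,X,H)$ be a minimal uncolorable degree-feasible configuration such that $D$ is bidirected. Then $H$ is bidirected.
   Context: Digraphs are finite, without loops and parallel arcs (opposite arcs allowed); connectivity means weak connectivity. A digraph is bidirected if for every arc $uv$ the opposite arc $vu$ is also an arc. A cover of a digraph $D$ is a pair $(X,H)$: pairwise disjoint sets $X_v$ ($v\in V(D)$), and a digraph $H$ on $\bigcup_v X_v$ with each $X_v$ independent, such that for each arc $uv\in A(D)$ the arcs of $H$ from $X_u$ to $X_v$ form a (possibly empty) matching and every arc of $H$ arises in this way. A feasible configuration is a triple $(D,X,H)$ with $D$ connected and $(X,H)$ a cover of $D$; degree-feasible means $|X_v|\ge\max\{d_D^+(v),d_D^-(v)\}$ for all $v$. An acyclic transversal is a set $T\subseteq V(H)$ with $|T\cap X_v|=1$ for all $v$ and $H[T]$ containing no directed cycle; the configuration is colorable if one exists, uncolorable otherwise, and minimal uncolorable if uncolorable but $(D,X,H-a)$ is colorable for every arc $a\in A(H)$. -}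

module Defs where

open import Data.Nat using (ℕ; _≤_; _⊔_)
open import Data.Fin using (Fin; _≟_)
open import Data.Bool using (Bool; true; false; if_then_else_; _∧_; not)
open import Data.List using (List; map)
open import Data.Nat.ListAction using (sum)
open import Data.List.Base using (allFin)
open import Data.Product using (Σ; _×_)
open import Relation.Nullary using (¬_)
open import Relation.Nullary.Decidable using (⌊_⌋)
open import Relation.Binary.PropositionalEquality using (_≡_; _≢_)
open import Relation.Binary.Construct.Closure.Symmetric using (SymClosure)
open import Relation.Binary.Construct.Closure.ReflexiveTransitive using (Star)
open import Relation.Binary.Construct.Closure.Transitive using (TransClosure)

-- A finite digraph on vertex set Fin n, given by its (Boolean) arc relation.
-- A Boolean relation automatically excludes parallel arcs; opposite arcs allowed.
record Digraph (n : ℕ) : Set where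
  field
    arc      : Fin n → Fin n → Bool
    loopless : ∀ v → arc v v ≡ false
open Digraph public

Arc : ∀ {n} → Digraph n → Fin n → Fin n → Set
Arc D u v = arc D u v ≡ true

countFin : ∀ {n} → (Fin n → Bool) → ℕ
countFin {n} p = sum (map (λ i → if p i then 1 else 0) (allFin n))

outdeg indeg : ∀ {n} → Digraph n → Fin n → ℕ
outdeg D v = countFin (λ w → arc D v w)
indeg  D v = countFin (λ w → arc D w v)

WeaklyConnected : ∀ {n} → Digraph n → Set
WeaklyConnected D = ∀ u v → Star (SymClosure (Arc D)) u v

Bidirected : ∀ {n} → Digraph n → Set
Bidirected D = ∀ u v → Arc D u v → Arc D v u

-- A cover (X,H) of D: H is a digraph on Fin m, and p x = v means x ∈ X_v
-- (so the X_v are pairwise disjoint and cover V(H)).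
record Cover {n : ℕ} (D : Digraph n) : Set where
  field
    m    : ℕ
    H    : Digraph m
    p    : Fin m → Fin n
    -- every arc of H arises from an arc of D (in particular each X_v is independent,
    -- as D is loopless)
    lift : ∀ x y → Arc H x y → Arc D (p x) (p y)
    -- arcs of H from X_u to X_v form a matching
    matchOut : ∀ x y y' → Arc H x y → Arc H x y' → p y ≡ p y' → y ≡ y'
    matchIn  : ∀ x x' y → Arc H x y → Arc H x' y → p x ≡ p x' → x ≡ x'
open Cover public

sizeX : ∀ {n} {D : Digraph n} → Cover D → Fin n → ℕ
sizeX C v = countFin (λ x → ⌊ p C x ≟ v ⌋)

DegreeFeasible : ∀ {n} (D : Digraph n) → Cover D → Set
DegreeFeasible D C = ∀ v → outdeg D v ⊔ indeg D v ≤ sizeX C v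

Acyclic : ∀ {k} → (Fin k → Fin k → Set) → Set
Acyclic {k} R = ∀ v → ¬ TransClosure R v v

-- an acyclic transversal, given by its choice function v ↦ the element of T ∩ X_v;
-- the arcs of H[T] are those of H between chosen vertices.
AcyclicTransversal : ∀ {n} {D : Digraph n} → (C : Cover D) → Digraph (m C) → Set
AcyclicTransversal {n} C G =
  Σ (Fin n → Fin (m C)) λ t →
    (∀ v → p C (t v) ≡ v) × Acyclic (λ u v → Arc G (t u) (t v))

removeArc : ∀ {k} → Digraph k → Fin k → Fin k → Digraph k
removeArc G x y = record
  { arc = λ a b → arc G a b ∧ not (⌊ a ≟ x ⌋ ∧ ⌊ b ≟ y ⌋)
  ; loopless = λ v → lem (arc G v v) _ (loopless G v) }
  where
  lem : ∀ b c → b ≡ false → b ∧ c ≡ false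
  lem false c _ = Relation.Binary.PropositionalEquality.refl

Colorable : ∀ {n} {D : Digraph n} → Cover D → Set
Colorable C = AcyclicTransversal C (H C)

ColorableMinus : ∀ {n} {D : Digraph n} → (C : Cover D) → Fin (m C) → Fin (m C) → Set
ColorableMinus C x y = AcyclicTransversal C (removeArc (H C) x y)

MinimalUncolorable : ∀ {n} (D : Digraph n) → Cover D → Set
MinimalUncolorable D C =
  WeaklyConnected D × ¬ Colorable C ×
  (∀ x y → Arc (H C) x y → ColorableMinus C x y)

module Submission where

-- Suppose H has an arc x → y but not y → x, and put u = p x, v = p y.
-- By minimality H - xy has an acyclic transversal T (a choice function t); since H
-- itself has none, T must contain both x and y.  The whole argument consists of
-- exchanging one vertex of T for another vertex of the same class and locating the
-- directed cycle that the new transversal is forced to carry: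
--   (1) the only H-arc from x into T is x → y;
--   (2) every z ∈ X_v has an H-arc into T avoiding X_u.
-- Statement (2) contradicts degree-feasibility at the D-arc v → u (which exists
-- because D is bidirected): the arcs of (2) form, by the matching property, an
-- injection of X_v into N⁺(v) ∖ {u}, so |X_v| < d⁺(v).  Statement (1) is proved by
-- the same counting argument at u.

open import Defs
open import Function using (_∘_; const)
open import Data.Nat using (ℕ; zero; suc; _≤_; _<_; _+_; z≤n; s≤s)
open import Data.Nat.Properties using (≤-trans; m≤m⊔n; +-suc; <-irrefl)
open import Data.Fin using (Fin; zero; suc; _≟_)
open import Data.Fin.Properties using (any?; suc-injective; 0≢1+n)
open import Data.Bool using (Bool; true; false; if_then_else_; _∧_; not)
import Data.Bool as Bool
open import Data.Bool.Properties using (∧-identityʳ)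
open import Data.List using (map; tabulate)
open import Data.List.Properties using (map-tabulate)
open import Data.Nat.ListAction using (sum)
open import Data.Product using (∃; _×_; _,_; proj₁; proj₂)
open import Data.Sum using (_⊎_; inj₁; inj₂)
import Data.Sum as Sum
open import Data.Empty using (⊥; ⊥-elim)
open import Data.Vec.Functional using (updateAt)
open import Data.Vec.Functional.Properties using (updateAt-updates; updateAt-minimal)
open import Relation.Nullary using (¬_; yes; no; Dec)
open import Relation.Nullary.Decidable using (⌊_⌋; _×-dec_; ¬?)
open import Relation.Binary.Definitions using (DecidableEquality)
open import Relation.Binary.PropositionalEquality
open import Relation.Binary.Construct.Closure.Transitive using (TransClosure; [_]; _∷_)

decided : ∀ {A : Set} (d : Dec A) → ⌊ d ⌋ ≡ true → A
decided (yes a) _ = a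
decided (no _) ()

indicator : Bool → ℕ
indicator b = if b then 1 else 0

countFin-suc : ∀ {n} (P : Fin (suc n) → Bool) →
               countFin P ≡ indicator (P zero) + countFin (P ∘ suc)
countFin-suc P = cong (indicator (P zero) +_) (begin
  sum (map (indicator ∘ P) (tabulate suc))   ≡⟨ cong sum (map-tabulate suc (indicator ∘ P)) ⟩
  sum (tabulate (indicator ∘ P ∘ suc))       ≡⟨ sym (cong sum (map-tabulate (λ i → i) (indicator ∘ P ∘ suc))) ⟩
  countFin (P ∘ suc)                         ∎)
  where open ≡-Reasoning

countFin-cong : ∀ {n} {P Q : Fin n → Bool} → (∀ i → P i ≡ Q i) → countFin P ≡ countFin Q
countFin-cong {zero}      _   = refl
countFin-cong {suc n} {P} {Q} P≗Q rewrite countFin-suc P | countFin-suc Q =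
  cong₂ _+_ (cong indicator (P≗Q zero)) (countFin-cong (P≗Q ∘ suc))

_without_ : ∀ {n} → (Fin n → Bool) → Fin n → Fin n → Bool
(P without c) i = P i ∧ not ⌊ i ≟ c ⌋

without-keeps : ∀ {n} (P : Fin n → Bool) {c i} → P i ≡ true → i ≢ c → (P without c) i ≡ true
without-keeps P {c} {i} Pi i≢c with i ≟ c
... | yes i≡c = ⊥-elim (i≢c i≡c)
... | no _    rewrite Pi = refl

countFin-without : ∀ {n} (P : Fin n → Bool) c → P c ≡ true →
                   suc (countFin (P without c)) ≡ countFin P
countFin-without P zero Pc
  rewrite countFin-suc (P without zero) | countFin-suc P | Pc =
  cong suc (countFin-cong (λ i → ∧-identityʳ (P (suc i))))
countFin-without P (suc c) Pc
  rewrite countFin-suc (P without suc c) | countFin-suc P | ∧-identityʳ (P zero) =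
  trans (sym (+-suc (indicator (P zero)) _)) (cong (indicator (P zero) +_)
    (trans (cong suc (countFin-cong (λ i → cong (λ b → P (suc i) ∧ not b) (suc-test i))))
           (countFin-without (P ∘ suc) c Pc)))
  where
  suc-test : ∀ i → ⌊ suc i ≟ suc c ⌋ ≡ ⌊ i ≟ c ⌋
  suc-test i with i ≟ c
  ... | yes _ = refl
  ... | no _  = refl

countFin-injection : ∀ {m n} (P : Fin m → Bool) (Q : Fin n → Bool) (g : Fin m → Fin n) →
  (∀ i → P i ≡ true → Q (g i) ≡ true) →
  (∀ i j → P i ≡ true → P j ≡ true → g i ≡ g j → i ≡ j) →
  countFin P ≤ countFin Q
countFin-injection {zero} _ _ _ _ _ = z≤n
countFin-injection {suc m} P Q g maps inj rewrite countFin-suc P with P zero in P0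
... | false = countFin-injection (P ∘ suc) Q (g ∘ suc) (maps ∘ suc)
                (λ i j Pi Pj → suc-injective ∘ inj (suc i) (suc j) Pi Pj)
... | true  = subst (suc (countFin (P ∘ suc)) ≤_) (countFin-without Q (g zero) (maps zero P0))
                (s≤s (countFin-injection (P ∘ suc) (Q without g zero) (g ∘ suc)
                  (λ i Pi → without-keeps Q (maps (suc i) Pi)
                              (0≢1+n ∘ sym ∘ inj (suc i) zero Pi P0))
                  (λ i j Pi Pj → suc-injective ∘ inj (suc i) (suc j) Pi Pj)))

countFin-injection-missing : ∀ {m n} (P : Fin m → Bool) (Q : Fin n → Bool) (g : Fin m → Fin n) c →
  Q c ≡ true →
  (∀ i → P i ≡ true → Q (g i) ≡ true × g i ≢ c) →
  (∀ i j → P i ≡ true → P j ≡ true → g i ≡ g j → i ≡ j) →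
  countFin P < countFin Q
countFin-injection-missing P Q g c Qc maps inj =
  subst (suc (countFin P) ≤_) (countFin-without Q c Qc)
    (s≤s (countFin-injection P (Q without c) g
      (λ i Pi → without-keeps Q (proj₁ (maps i Pi)) (proj₂ (maps i Pi))) inj))

TransClosure-mono : ∀ {A : Set} {R S : A → A → Set} → (∀ {a b} → R a b → S a b) →
                    ∀ {a b} → TransClosure R a b → TransClosure S a b
TransClosure-mono f [ r ]      = [ f r ]
TransClosure-mono f (r ∷ rest) = f r ∷ TransClosure-mono f rest

module ClosedWalks {A : Set} (_≟ᴬ_ : DecidableEquality A) where

  first-arc : ∀ {R : A → A → Set} {a b} → TransClosure R a b → ∃ (R a)
  first-arc [ r ]   = _ , r
  first-arc (r ∷ _) = _ , r

  module _ {R S : A → A → Set} (w : A)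
           (away : ∀ {a b} → a ≢ w → b ≢ w → R a b → S a b) where

    walk-through : ∀ {a b} → a ≢ w → b ≢ w → TransClosure R a b → TransClosure S a b ⊎ ∃ (R w)
    walk-through a≢w b≢w [ r ] = inj₁ [ away a≢w b≢w r ]
    walk-through a≢w b≢w (_∷_ {y = c} r rest) with c ≟ᴬ w
    ... | yes refl = inj₂ (first-arc rest)
    ... | no c≢w   = Sum.map₁ (away a≢w c≢w r ∷_) (walk-through c≢w b≢w rest)

    cycle-through : ∀ {a} → TransClosure R a a → TransClosure S a a ⊎ ∃ (R w)
    cycle-through {a} cyc with a ≟ᴬ w
    ... | yes refl = inj₂ (first-arc cyc)
    ... | no a≢w   = walk-through a≢w a≢w cyc

  _minus_ : (A → A → Set) → A → A → A → Set
  (R minus w) a b = R a b × a ≢ w × b ≢ w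

  cycle-avoids-sink : ∀ {R : A → A → Set} w → (∀ b → ¬ R w b) →
                      ∀ {a} → TransClosure R a a → TransClosure (R minus w) a a
  cycle-avoids-sink w sink cyc with cycle-through w (λ a≢w b≢w r → r , a≢w , b≢w) cyc
  ... | inj₁ cyc′    = cyc′
  ... | inj₂ (b , r) = ⊥-elim (sink b r)

removeArc-keeps : ∀ {k} (G : Digraph k) {x y a b} → Arc G a b → a ≢ x ⊎ b ≢ y →
                  Arc (removeArc G x y) a b
removeArc-keeps G {x} {y} {a} {b} r other rewrite r with a ≟ x | b ≟ y
... | yes a≡x | yes b≡y = ⊥-elim (Sum.[ (λ a≢x → a≢x a≡x) , (λ b≢y → b≢y b≡y) ] other)
... | yes _   | no _    = refl
... | no _    | _       = refl

no-loop : ∀ {k} (G : Digraph k) z → ¬ Arc G z z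
no-loop G z r with trans (sym r) (loopless G z)
... | ()

module _ {n} {D : Digraph n} (C : Cover D) where

  ArcInto : (Fin n → Fin (m C)) → Fin (m C) → Fin n → Set
  ArcInto t z w = ∃ λ c → Arc (H C) z (t c) × c ≢ w

  -- Such arcs, one per z ∈ X_a, land in distinct
  -- classes (the arcs from X_a to X_c form a matching), giving an injection of
  -- X_a into N⁺(a) ∖ {w}, whence |X_a| < d⁺(a) ≤ |X_a|.
  no-total-exit : DegreeFeasible D C →
    (t : Fin n → Fin (m C)) → (∀ c → p C (t c) ≡ c) →
    ∀ {a w} → Arc D a w → ¬ (∀ z → p C z ≡ a → ¬ ¬ ArcInto t z w)
  no-total-exit feasible t t-in {a} {w} aw exits =
    <-irrefl refl (≤-trans |Xa|<d⁺ (≤-trans (m≤m⊔n _ _) (feasible a)))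
    where
    exit? : ∀ z → Dec (ArcInto t z w)
    exit? z = any? (λ c → (arc (H C) z (t c) Bool.≟ true) ×-dec ¬? (c ≟ w))

    target : Fin (m C) → Fin n
    target z with exit? z
    ... | yes (c , _) = c
    ... | no _        = w

    target-spec : ∀ z → p C z ≡ a → Arc (H C) z (t (target z)) × target z ≢ w
    target-spec z pz with exit? z
    ... | yes (_ , spec) = spec
    ... | no none        = ⊥-elim (exits z pz none)

    |Xa|<d⁺ : sizeX C a < outdeg D a
    |Xa|<d⁺ = countFin-injection-missing _ (arc D a) target w aw
      (λ z z∈Xa → let pz = decided (p C z ≟ a) z∈Xa in
        subst₂ (Arc D) pz (t-in (target z)) (lift C _ _ (proj₁ (target-spec z pz))) ,
        proj₂ (target-spec z pz))
      (λ z z′ z∈Xa z′∈Xa same →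
        let pz = decided (p C z ≟ a) z∈Xa ; pz′ = decided (p C z′ ≟ a) z′∈Xa in
        matchIn C z z′ _ (proj₁ (target-spec z pz))
          (subst (λ c → Arc (H C) z′ (t c)) (sym same) (proj₁ (target-spec z′ pz′)))
          (trans pz (sym pz′)))

module Counterexample {n} {D : Digraph n} (C : Cover D)
  (uncolorable : ¬ Colorable C)
  (minimal : ∀ x y → Arc (H C) x y → ColorableMinus C x y)
  (feasible : DegreeFeasible D C) (bidirected : Bidirected D)
  {x y : Fin (m C)} (x→y : Arc (H C) x y) (¬y→x : ¬ Arc (H C) y x) where

  open ClosedWalks (_≟_ {n})

  u v : Fin n
  u = p C x
  v = p C y

  t : Fin n → Fin (m C)
  t = proj₁ (minimal x y x→y)

  t-in : ∀ a → p C (t a) ≡ a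
  t-in = proj₁ (proj₂ (minimal x y x→y))

  _⇒_ : Fin n → Fin n → Set
  a ⇒ b = Arc (removeArc (H C) x y) (t a) (t b)

  T-acyclic : Acyclic _⇒_
  T-acyclic = proj₂ (proj₂ (minimal x y x→y))

  index : ∀ {a z} → t a ≡ z → a ≡ p C z
  index {a} e = trans (sym (t-in a)) (cong (p C) e)

  lift-T : ∀ {z c} → Arc (H C) z (t c) → Arc D (p C z) c
  lift-T {z} {c} r = subst (Arc D (p C z)) (t-in c) (lift C z (t c) r)

  u≢v : u ≢ v
  u≢v u≡v = no-loop D v (subst (λ a → Arc D a v) u≡v (lift C x y x→y))

  survives : ∀ {a b} → a ≢ u ⊎ b ≢ v → Arc (H C) (t a) (t b) → a ⇒ b
  survives other r = removeArc-keeps (H C) r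
    (Sum.map (λ a≢u → a≢u ∘ index) (λ b≢v → b≢v ∘ index) other)

  -- If H[T] = (H - xy)[T], then T would colour H; hence T contains both x and y.
  T-colours-H : (∀ {a b} → Arc (H C) (t a) (t b) → a ⇒ b) → ⊥
  T-colours-H keep = uncolorable (t , t-in , λ a → T-acyclic a ∘ TransClosure-mono keep)

  t-u : t u ≡ x
  t-u with t u ≟ x
  ... | yes t-u≡x = t-u≡x
  ... | no t-u≢x  = ⊥-elim (T-colours-H (λ r → removeArc-keeps (H C) r
                      (inj₁ (λ e → t-u≢x (subst (λ a → t a ≡ x) (index e) e)))))

  t-v : t v ≡ y
  t-v with t v ≟ y
  ... | yes t-v≡y = t-v≡y
  ... | no t-v≢y  = ⊥-elim (T-colours-H (λ r → removeArc-keeps (H C) r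
                      (inj₂ (λ e → t-v≢y (subst (λ a → t a ≡ y) (index e) e)))))

  swap : Fin n → Fin (m C) → Fin n → Fin (m C)
  swap a z = updateAt t a (const z)

  Swapped : Fin n → Fin (m C) → Fin n → Fin n → Set
  Swapped a z b c = Arc (H C) (swap a z b) (swap a z c)

  -- For z ∈ X_a the exchanged set is again a transversal, so it carries a cycle.
  swap-cyclic : ∀ {a z} → p C z ≡ a → ¬ Acyclic (Swapped a z)
  swap-cyclic {a} {z} pz acyclic = uncolorable (swap a z , swap-in , acyclic)
    where
    swap-in : ∀ b → p C (swap a z b) ≡ b
    swap-in b with b ≟ a
    ... | yes refl = trans (cong (p C) (updateAt-updates b t)) pz
    ... | no b≢a   = trans (cong (p C) (updateAt-minimal b a t b≢a)) (t-in b)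

  swap-away : ∀ {a z b c} → b ≢ a → c ≢ a → Swapped a z b c → Arc (H C) (t b) (t c)
  swap-away {a} {_} {b} {c} b≢a c≢a =
    subst₂ (Arc (H C)) (updateAt-minimal b a t b≢a) (updateAt-minimal c a t c≢a)

  swap-exit : ∀ {a z c} → Swapped a z a c → c ≢ a × Arc (H C) z (t c)
  swap-exit {a} {z} {c} r with c ≟ a
  ... | yes refl = ⊥-elim (no-loop (H C) z (subst₂ (Arc (H C)) new new r))
    where new = updateAt-updates a t
  ... | no c≢a   = c≢a , subst₂ (Arc (H C)) (updateAt-updates a t) (updateAt-minimal c a t c≢a) r

  -- (1) The only arc of H from x into T is x → y.  Otherwise, with x → t c for
  -- c ≠ v, every z ∈ X_u has an arc into T outside X_c: for z = x this is x → y;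
  -- for z ≠ x the transversal T[u := z] has a cycle, which must leave z along an
  -- arc z → t d, and d ≠ c since the arcs from X_u to X_c form a matching.
  x-only-to-v : ∀ c → Arc (H C) x (t c) → c ≡ v
  x-only-to-v c x→c with c ≟ v
  ... | yes c≡v = c≡v
  ... | no c≢v  = ⊥-elim (no-total-exit C feasible t t-in (lift-T x→c) exits)
    where
    exits : ∀ z → p C z ≡ u → ¬ ¬ ArcInto C t z c
    exits z pz no-exit with z ≟ x
    ... | yes refl = no-exit (v , subst (Arc (H C) x) (sym t-v) x→y , c≢v ∘ sym)
    ... | no z≢x   = swap-cyclic pz escape
      where
      away : ∀ {b d} → b ≢ u → d ≢ u → Swapped u z b d → b ⇒ d
      away b≢u d≢u r = survives (inj₁ b≢u) (swap-away b≢u d≢u r)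

      escape : Acyclic (Swapped u z)
      escape b cyc with cycle-through {S = _⇒_} u away cyc
      ... | inj₁ cyc′    = T-acyclic b cyc′
      ... | inj₂ (d , r) with swap-exit r
      ...   | _ , z→d = no-exit (d , z→d ,
                λ d≡c → z≢x (matchIn C z x (t c) (subst (λ e → Arc (H C) z (t e)) d≡c z→d) x→c pz))

  -- (2) Every z ∈ X_v has an arc into T outside X_u.  For z = y, T itself has a
  -- cycle in H, which must use x → y and so leave y; it cannot return to x as
  -- y → x is missing.  For z ≠ y, the class X_u is a sink of T[v := z] by (1) and
  -- the matching property, so a cycle there avoids X_u and must leave z.
  v-exits : ∀ z → p C z ≡ v → ¬ ¬ ArcInto C t z u
  v-exits z pz no-exit with z ≟ y
  ... | yes refl = uncolorable (t , t-in , escape)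
    where
    escape : Acyclic (λ b c → Arc (H C) (t b) (t c))
    escape b cyc with cycle-through {S = _⇒_} v (λ _ c≢v r → survives (inj₂ c≢v) r) cyc
    ... | inj₁ cyc′ = T-acyclic b cyc′
    ... | inj₂ (c , r) with c ≟ u
    ...   | yes refl = ¬y→x (subst₂ (Arc (H C)) t-v t-u r)
    ...   | no c≢u   = no-exit (c , subst (λ w → Arc (H C) w (t c)) t-v r , c≢u)
  ... | no z≢y   = swap-cyclic pz escape
    where
    x-unchanged : swap v z u ≡ x
    x-unchanged = trans (updateAt-minimal u v t u≢v) t-u

    u-sink : ∀ c → ¬ Swapped v z u c
    u-sink c r with c ≟ v
    ... | yes refl = z≢y (matchOut C x z y
                       (subst₂ (Arc (H C)) x-unchanged (updateAt-updates v t) r) x→y pz)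
    ... | no c≢v   = c≢v (x-only-to-v c (subst (λ w → Arc (H C) w (t c)) t-u (swap-away u≢v c≢v r)))

    away : ∀ {b c} → b ≢ v → c ≢ v → (Swapped v z minus u) b c → b ⇒ c
    away b≢v c≢v (r , b≢u , _) = survives (inj₁ b≢u) (swap-away b≢v c≢v r)

    escape : Acyclic (Swapped v z)
    escape b cyc with cycle-through {S = _⇒_} v away (cycle-avoids-sink u u-sink cyc)
    ... | inj₁ cyc′               = T-acyclic b cyc′
    ... | inj₂ (c , r , _ , c≢u) = no-exit (c , proj₂ (swap-exit r) , c≢u)

  impossible : ⊥
  impossible = no-total-exit C feasible t t-in (bidirected u v (lift C x y x→y)) v-exits

corollary13 : (n : ℕ) (D : Digraph n) (C : Cover D) →
              MinimalUncolorable D C → DegreeFeasible D C → Bidirected D →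
              Bidirected (H C)
corollary13 n D C (_ , uncolorable , minimal) feasible bidirected x y x→y
  with arc (H C) y x Bool.≟ true
... | yes y→x = y→x
... | no ¬y→x = ⊥-elim (Counterexample.impossible C uncolorable minimal feasible bidirected x→y ¬y→x)
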